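{- Let $p$ be a prime, let $a\in\mathbb{Z}$, and let $l,l',m$ be positive integers with $l'\geqslant l>m/p$ and $$l'\equiv l \pmod{(p-1)p^{\lfloor\log_p m\rfloor-\delta_p(a,m)}},$$ where $\delta_p(a,m)=1$ if $p\mid a$ and $\log_p m$ is a positive integer, and $\delta_p(a,m)=0$ otherwise. Then $$\sum_{j=0}^{l'}\binom{l'}{j}S(j,m)a^{l'-j}\equiv\sum_{j=0}^{l}\binom{l}{j}S(j,m)a^{l-j}\pmod p.$$
   Context: $S(j,m)$ denotes the Stirling number of the second kind: for $j+m>0$ it is the number of ways to partition a set of $j$ elements into $m$ nonempty subsets, and $S(0,0)=1$. Equivalently $x^j=\sum_{i=0}^{j}S(j,i)(x)_i$ where $(x)_i=\prod_{0\le t<i}(x-t)$. The convention $0^0=1$ is used. -}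

module Defs where

open import Data.Nat as ℕ using (ℕ; zero; suc; _≤_; _<_)
open import Data.Nat.Combinatorics using (_C_)
open import Data.Integer as ℤ using (ℤ; +_)
open import Data.Bool using (Bool; true; false; _∧_)
open import Relation.Nullary.Decidable using (⌊_⌋)
open import Data.Nat.Divisibility using (_∣?_)

S : ℕ → ℕ → ℕ
S zero zero = 1
S zero (suc m) = 0
S (suc j) zero = 0
S (suc j) (suc m) = suc m ℕ.* S j (suc m) ℕ.+ S j m

sumTo : ℕ → (ℕ → ℤ) → ℤ
sumTo zero f = f 0
sumTo (suc n) f = sumTo n f ℤ.+ f (suc n)

-- The sum Σ_{j=0}^{l} C(l,j) S(j,m) a^{l-j}  (ℤ powers, 0^0 = 1)
T : ℤ → ℕ → ℕ → ℤ
T a m l = sumTo l (λ j → (+ (l C j)) ℤ.* (+ S j m) ℤ.* (a ℤ.^ (l ℕ.∸ j)))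

-- δ_p(a,m), given e = ⌊log_p m⌋ : it is 1 iff p ∣ a and log_p m is a
-- positive integer, i.e. e ≥ 1 and p^e = m.
δ : (p : ℕ) → ℤ → (m e : ℕ) → ℕ
δ p a m e = δ' (⌊ p ∣? ℤ.∣ a ∣ ⌋ ∧ ⌊ 1 ℕ.≤? e ⌋ ∧ ⌊ p ℕ.^ e ℕ.≟ m ⌋)
  where
  δ' : Bool → ℕ
  δ' true = 1
  δ' false = 0

-- Let E be the shift of integer sequences, (E y) l = y (l + 1).  As a sequence in l, T a m is
-- annihilated by (E − a)(E − a − 1) ⋯ (E − a − m), since T a m (l + 1) = (a + m) T a m l + T a (m − 1) l.
-- Modulo p, any p consecutive factors (E − c) ⋯ (E − c − p + 1) multiply to E^p − E: expand (E − c)^p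
-- in falling factorials with Stirling numbers, use p ∣ S(p,k) for 1 < k < p, and the Frobenius
-- congruence (E − c)^p ≡ E^p − c.
-- Write m + 1 = r + qp with 1 ≤ r ≤ p.  Completing the first r factors to p consecutive ones shows that
-- (E^p − E)^(q+1) annihilates T mod p, so (E^(p−1) − 1)^(q+1) annihilates it from index q + 1 on.  When
-- δ = 1, i.e. m = p^e and p ∣ a, the extra factor E − a is ≡ E, and already (E^(p−1) − 1)^(p^(e−1))
-- annihilates T from index p^(e−1) + 1 on.
-- Finally (E^(p−1) − 1)^(p^s) ≡ E^((p−1)p^s) − 1 mod p.  Taking s = e (note q + 1 ≤ p^e as m < p^(e+1)),
-- resp. s = e − 1, T is periodic mod p with period (p − 1)p^s from that index on, and the hypothesis
-- l > m/p places l beyond it.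
module Submission where

open import Defs

module _ where

  open import Data.Empty using (⊥-elim)
  open import Data.Integer as ℤ using (ℤ; +_; 0ℤ; 1ℤ; -1ℤ; _+_; _*_; _-_; -_; _^_)
  import Data.Integer.Divisibility as Unsigned
  open import Data.Integer.Divisibility.Signed as Signed using (divides)
  open import Data.Integer.DivMod using (_%ℕ_; _/ℕ_; a≡a%ℕn+[a/ℕn]*n)
  import Data.Integer.Properties as ℤ
  open import Data.Integer.Tactic.RingSolver using (solve-∀)
  open import Data.Nat as ℕ using (ℕ; zero; suc; _!; z≤n; s≤s)
  open import Data.Nat.Combinatorics
    using (_C_; nCk+nC[k+1]≡[n+1]C[k+1]; k>n⇒nCk≡0; nCn≡1; nCk≡n!/k![n-k]!; k![n∸k]!∣n!)
  open import Data.Nat.Divisibility using (_∣_; _∣?_; divides; ∣1⇒≡1; ∣⇒≤; m∣m*n)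
  open import Data.Nat.DivMod using (_/_; _%_; m/n*n≡m; m/n*n≤m; m≡m%n+[m/n]*n; m%n<n)
  open import Data.Nat.GeneralisedArithmetic using (iterate)
  open import Data.Nat.Induction using (<-rec)
  open import Data.Nat.Primality using (Prime; euclidsLemma; prime⇒nonTrivial)
  import Data.Nat.Properties as ℕ
  open import Data.Product using (_×_; _,_)
  open import Data.Sum using (_⊎_; inj₁; inj₂)
  open import Level using (0ℓ)
  open import Relation.Binary.Bundles using (Setoid)
  open import Relation.Binary.PropositionalEquality
  import Relation.Binary.Reasoning.Setoid
  open import Relation.Nullary using (¬_; yes; no)

  sumTo-cong : ∀ n {f g : ℕ → ℤ} → (∀ j → j ℕ.≤ n → f j ≡ g j) → sumTo n f ≡ sumTo n g
  sumTo-cong zero    f≡g = f≡g 0 z≤n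
  sumTo-cong (suc n) f≡g =
    cong₂ _+_ (sumTo-cong n (λ j j≤n → f≡g j (ℕ.m≤n⇒m≤1+n j≤n))) (f≡g (suc n) ℕ.≤-refl)

  sumTo-distrib-+ : ∀ n (f g : ℕ → ℤ) → sumTo n (λ j → f j + g j) ≡ sumTo n f + sumTo n g
  sumTo-distrib-+ zero    f g = refl
  sumTo-distrib-+ (suc n) f g rewrite sumTo-distrib-+ n f g =
    lemma (sumTo n f) (sumTo n g) (f (suc n)) (g (suc n))
    where lemma : ∀ a b c d → a + b + (c + d) ≡ a + c + (b + d)
          lemma = solve-∀

  *-distribˡ-sumTo : ∀ n c (f : ℕ → ℤ) → c * sumTo n f ≡ sumTo n (λ j → c * f j)
  *-distribˡ-sumTo zero    c f = refl
  *-distribˡ-sumTo (suc n) c f rewrite sym (*-distribˡ-sumTo n c f) =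
    ℤ.*-distribˡ-+ c (sumTo n f) (f (suc n))

  sumTo-truncate : ∀ {k n} (f : ℕ → ℤ) → k ℕ.≤ n → (∀ i → k ℕ.< i → f i ≡ 0ℤ) →
                   sumTo n f ≡ sumTo k f
  sumTo-truncate {k} f k≤n f≡0 = go (ℕ.≤⇒≤′ k≤n)
    where
    go : ∀ {n} → k ℕ.≤′ n → sumTo n f ≡ sumTo k f
    go ℕ.≤′-refl            = refl
    go (ℕ.≤′-step {n} k≤′n) = begin
      sumTo n f + f (suc n)  ≡⟨ cong₂ _+_ (go k≤′n) (f≡0 (suc n) (s≤s (ℕ.≤′⇒≤ k≤′n))) ⟩
      sumTo k f + 0ℤ         ≡⟨ ℤ.+-identityʳ _ ⟩
      sumTo k f              ∎
      where open ≡-Reasoning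

  -- Summation by parts along the recurrence shared by Pascal's and Stirling's triangles.
  sumTo-triangle : (F : ℕ → ℕ → ℤ) (α : ℕ → ℤ) →
    (∀ n → F (suc n) 0 ≡ α 0 * F n 0) →
    (∀ n k → F (suc n) (suc k) ≡ α (suc k) * F n (suc k) + F n k) →
    (∀ n → F n (suc n) ≡ 0ℤ) →
    ∀ n (h : ℕ → ℤ) →
    sumTo (suc n) (λ k → F (suc n) k * h k) ≡ sumTo n (λ k → F n k * (α k * h k + h (suc k)))
  sumTo-triangle F α F-zero F-suc F-above n h = begin
    sumTo (suc n) (λ k → F (suc n) k * h k)
      ≡⟨ partial n ⟩
    sumTo n g + α (suc n) * F n (suc n) * h (suc n)
      ≡⟨ cong (λ x → sumTo n g + α (suc n) * x * h (suc n)) (F-above n) ⟩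
    sumTo n g + α (suc n) * 0ℤ * h (suc n)
      ≡⟨ drop (sumTo n g) (α (suc n)) (h (suc n)) ⟩
    sumTo n g
      ∎
    where
    open ≡-Reasoning
    g : ℕ → ℤ
    g k = F n k * (α k * h k + h (suc k))
    drop : ∀ s a b → s + a * 0ℤ * b ≡ s
    drop = solve-∀
    partial : ∀ N → sumTo (suc N) (λ k → F (suc n) k * h k)
                    ≡ sumTo N g + α (suc N) * F n (suc N) * h (suc N)
    partial zero rewrite F-zero n | F-suc n 0 =
      lemma (α 0) (F n 0) (h 0) (α 1) (F n 1) (h 1)
      where lemma : ∀ a b c d e f → a * b * c + (d * e + b) * f ≡ b * (a * c + f) + d * e * f
            lemma = solve-∀
    partial (suc N) rewrite partial N | F-suc n (suc N) =
      lemma (sumTo N g) (α (suc N)) (F n (suc N)) (h (suc N))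
            (α (suc (suc N))) (F n (suc (suc N))) (h (suc (suc N)))
      where lemma : ∀ s a b c d e f → s + a * b * c + (d * e + b) * f ≡ s + b * (a * c + f) + d * e * f
            lemma = solve-∀

  -- Binomial coefficients, Stirling numbers and falling factorials

  Cℤ : ℕ → ℕ → ℤ
  Cℤ n k = + (n C k)

  sumTo-pascal : ∀ n (h : ℕ → ℤ) →
    sumTo (suc n) (λ k → Cℤ (suc n) k * h k) ≡ sumTo n (λ k → Cℤ n k * (h k + h (suc k)))
  sumTo-pascal n h = trans
    (sumTo-triangle Cℤ (λ _ → 1ℤ) (λ _ → refl) pascal (λ n → cong +_ (k>n⇒nCk≡0 (ℕ.n<1+n n))) n h)
    (sumTo-cong n (λ k _ → cong (λ x → Cℤ n k * (x + h (suc k))) (ℤ.*-identityˡ (h k))))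
    where
    pascal : ∀ n k → Cℤ (suc n) (suc k) ≡ 1ℤ * Cℤ n (suc k) + Cℤ n k
    pascal n k = begin
      + (suc n C suc k)              ≡⟨ cong +_ (nCk+nC[k+1]≡[n+1]C[k+1] n k) ⟨
      + (n C k ℕ.+ n C suc k)        ≡⟨ ℤ.pos-+ (n C k) (n C suc k) ⟩
      Cℤ n k + Cℤ n (suc k)          ≡⟨ ℤ.+-comm (Cℤ n k) (Cℤ n (suc k)) ⟩
      Cℤ n (suc k) + Cℤ n k          ≡⟨ cong (_+ Cℤ n k) (ℤ.*-identityˡ (Cℤ n (suc k))) ⟨
      1ℤ * Cℤ n (suc k) + Cℤ n k     ∎
      where open ≡-Reasoning

  nCk*[k!*[n∸k]!]≡n! : ∀ {n k} → k ℕ.≤ n → (n C k) ℕ.* (k ! ℕ.* (n ℕ.∸ k) !) ≡ n !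
  nCk*[k!*[n∸k]!]≡n! {n} {k} k≤n = begin
    (n C k) ℕ.* (k ! ℕ.* (n ℕ.∸ k) !)
      ≡⟨ cong (ℕ._* (k ! ℕ.* (n ℕ.∸ k) !)) (nCk≡n!/k![n-k]! k≤n) ⟩
    n ! ℕ./ (k ! ℕ.* (n ℕ.∸ k) !) ℕ.* (k ! ℕ.* (n ℕ.∸ k) !)
      ≡⟨ m/n*n≡m (k![n∸k]!∣n! k≤n) ⟩
    n ! ∎
    where
    open ≡-Reasoning
    instance _ = ℕ._!*_!≢0 k (n ℕ.∸ k)

  Sℤ : ℕ → ℕ → ℤ
  Sℤ n k = + S n k

  n<k⇒S[n,k]≡0 : ∀ {n k} → n ℕ.< k → S n k ≡ 0
  n<k⇒S[n,k]≡0 {zero}  {suc k} _ = refl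
  n<k⇒S[n,k]≡0 {suc n} {suc k} (s≤s n<k) rewrite n<k⇒S[n,k]≡0 (ℕ.m<n⇒m<1+n n<k) | n<k⇒S[n,k]≡0 n<k =
    trans (ℕ.+-identityʳ _) (ℕ.*-zeroʳ k)

  S[1+n,1]≡1 : ∀ n → S (suc n) 1 ≡ 1
  S[1+n,1]≡1 zero    = refl
  S[1+n,1]≡1 (suc n) rewrite S[1+n,1]≡1 n = refl

  S[n,n]≡1 : ∀ n → S n n ≡ 1
  S[n,n]≡1 zero    = refl
  S[n,n]≡1 (suc n) rewrite n<k⇒S[n,k]≡0 (ℕ.n<1+n n) | S[n,n]≡1 n = cong (ℕ._+ 1) (ℕ.*-zeroʳ n)

  Sℤ-suc : ∀ n k → Sℤ (suc n) (suc k) ≡ + suc k * Sℤ n (suc k) + Sℤ n k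
  Sℤ-suc n k = trans (ℤ.pos-+ (suc k ℕ.* S n (suc k)) (S n k))
                     (cong (_+ Sℤ n k) (ℤ.pos-* (suc k) (S n (suc k))))

  sumTo-stirling : ∀ n (h : ℕ → ℤ) →
    sumTo (suc n) (λ k → Sℤ (suc n) k * h k) ≡ sumTo n (λ k → Sℤ n k * (+ k * h k + h (suc k)))
  sumTo-stirling = sumTo-triangle Sℤ +_ (λ _ → refl) Sℤ-suc (λ n → cong +_ (n<k⇒S[n,k]≡0 (ℕ.n<1+n n)))

  falling : ℤ → ℕ → ℤ
  falling x zero    = 1ℤ
  falling x (suc k) = falling x k * (x - + k)

  ^≡sumTo-S*falling : ∀ x n → x ^ n ≡ sumTo n (λ k → Sℤ n k * falling x k)
  ^≡sumTo-S*falling x zero    = refl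
  ^≡sumTo-S*falling x (suc n) = begin
    x * x ^ n
      ≡⟨ cong (x *_) (^≡sumTo-S*falling x n) ⟩
    x * sumTo n (λ k → Sℤ n k * falling x k)
      ≡⟨ *-distribˡ-sumTo n x _ ⟩
    sumTo n (λ k → x * (Sℤ n k * falling x k))
      ≡⟨ sumTo-cong n (λ k _ → lemma (Sℤ n k) (+ k) (falling x k) x) ⟩
    sumTo n (λ k → Sℤ n k * (+ k * falling x k + falling x (suc k)))
      ≡⟨ sumTo-stirling n (falling x) ⟨
    sumTo (suc n) (λ k → Sℤ (suc n) k * falling x k)
      ∎
    where
    open ≡-Reasoning
    lemma : ∀ s k f x → x * (s * f) ≡ s * (k * f + f * (x - k))
    lemma = solve-∀

  falling-suc : ∀ x k → falling (1ℤ + x) (suc k) ≡ (1ℤ + x) * falling x k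
  falling-suc x zero    = lemma x
    where lemma : ∀ x → 1ℤ * (1ℤ + x - 0ℤ) ≡ (1ℤ + x) * 1ℤ
          lemma = solve-∀
  falling-suc x (suc k) rewrite falling-suc x k = lemma x (falling x k) (+ k)
    where lemma : ∀ x f k → (1ℤ + x) * f * (1ℤ + x - (1ℤ + k)) ≡ (1ℤ + x) * (f * (x - k))
          lemma = solve-∀

  falling[k,k]≡k! : ∀ k → falling (+ k) k ≡ + (k !)
  falling[k,k]≡k! zero    = refl
  falling[k,k]≡k! (suc k) = begin
    falling (1ℤ + + k) (suc k)  ≡⟨ falling-suc (+ k) k ⟩
    + suc k * falling (+ k) k   ≡⟨ cong (+ suc k *_) (falling[k,k]≡k! k) ⟩
    + suc k * + (k !)           ≡⟨ ℤ.pos-* (suc k) (k !) ⟨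
    + (suc k !)                 ∎
    where open ≡-Reasoning

  k<j⇒falling[k,j]≡0 : ∀ {k j} → k ℕ.< j → falling (+ k) j ≡ 0ℤ
  k<j⇒falling[k,j]≡0 {k} (s≤s k≤j) = go (ℕ.≤⇒≤′ k≤j)
    where
    go : ∀ {j} → k ℕ.≤′ j → falling (+ k) (suc j) ≡ 0ℤ
    go ℕ.≤′-refl = trans (cong (falling (+ k) k *_) (ℤ.+-inverseʳ (+ k))) (ℤ.*-zeroʳ (falling (+ k) k))
    go (ℕ.≤′-step {j} k≤′j) =
      trans (cong (_* (+ k - + suc j)) (go k≤′j)) (ℤ.*-zeroˡ (+ k - + suc j))

  -- Shift operators on integer sequences

  Seq : Set
  Seq = ℕ → ℤ

  Op : Set
  Op = Seq → Seq

  Extensional : Op → Set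
  Extensional F = ∀ {y z} → y ≗ z → F y ≗ F z

  -- Δ k c is the operator E^k − c.
  Δ : ℕ → ℤ → Op
  Δ k c y l = y (l ℕ.+ k) - c * y l

  Δ-ext : ∀ k c → Extensional (Δ k c)
  Δ-ext k c y≗z l = cong₂ (λ u v → u - c * v) (y≗z (l ℕ.+ k)) (y≗z l)

  iterate-ext : ∀ {F} → Extensional F → ∀ n → Extensional (λ y → iterate F y n)
  iterate-ext F-ext zero    y≗z = y≗z
  iterate-ext F-ext (suc n) y≗z = iterate-ext F-ext n (F-ext y≗z)

  iterate-suc : ∀ {A : Set} (F : A → A) y n → iterate F (F y) n ≡ F (iterate F y n)
  iterate-suc F y zero    = refl
  iterate-suc F y (suc n) = iterate-suc F (F y) n

  iterate-+ : ∀ {A : Set} (F : A → A) y m n → iterate F y (m ℕ.+ n) ≡ iterate F (iterate F y m) n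
  iterate-+ F y zero    n = refl
  iterate-+ F y (suc m) n = iterate-+ F (F y) m n

  iterate-* : ∀ {A : Set} (F : A → A) y m n →
              iterate F y (m ℕ.* n) ≡ iterate (λ z → iterate F z n) y m
  iterate-* F y zero    n = refl
  iterate-* F y (suc m) n = trans (iterate-+ F y n (m ℕ.* n)) (iterate-* F (iterate F y n) m n)

  iterate-Δ-suc : ∀ k c n (y : Seq) u →
                  iterate (Δ k c) (λ t → y (suc t)) n u ≡ iterate (Δ k c) y n (suc u)
  iterate-Δ-suc k c zero    y u = refl
  iterate-Δ-suc k c (suc n) y u = iterate-Δ-suc k c n (Δ k c y) u

  iterate-Δ-binomial : ∀ n k c (y : Seq) l →
    iterate (Δ k c) y n l ≡ sumTo n (λ j → Cℤ n j * ((- c) ^ (n ℕ.∸ j) * y (l ℕ.+ k ℕ.* j)))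
  iterate-Δ-binomial zero k c y l rewrite ℕ.*-zeroʳ k | ℕ.+-identityʳ l =
    sym (trans (ℤ.*-identityˡ (1ℤ * y l)) (ℤ.*-identityˡ (y l)))
  iterate-Δ-binomial (suc n) k c y l = begin
    iterate (Δ k c) (Δ k c y) n l
      ≡⟨ iterate-Δ-binomial n k c (Δ k c y) l ⟩
    sumTo n (λ j → Cℤ n j * ((- c) ^ (n ℕ.∸ j) * Δ k c y (l ℕ.+ k ℕ.* j)))
      ≡⟨ sumTo-cong n (λ j j≤n → cong (Cℤ n j *_) (term j j≤n)) ⟨
    sumTo n (λ j → Cℤ n j * (h j + h (suc j)))
      ≡⟨ sumTo-pascal n h ⟨
    sumTo (suc n) (λ j → Cℤ (suc n) j * h j)
      ∎
    where
    open ≡-Reasoning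
    h : ℕ → ℤ
    h j = (- c) ^ (suc n ℕ.∸ j) * y (l ℕ.+ k ℕ.* j)
    term : ∀ j → j ℕ.≤ n → h j + h (suc j) ≡ (- c) ^ (n ℕ.∸ j) * Δ k c y (l ℕ.+ k ℕ.* j)
    term j j≤n
      rewrite ℕ.+-∸-assoc 1 j≤n
            | ℕ.*-suc k j
            | ℕ.+-comm k (k ℕ.* j)
            | sym (ℕ.+-assoc l (k ℕ.* j) k) =
      lemma c ((- c) ^ (n ℕ.∸ j)) (y (l ℕ.+ k ℕ.* j)) (y (l ℕ.+ k ℕ.* j ℕ.+ k))
      where lemma : ∀ c e u v → (- c) * e * u + e * v ≡ e * (v - c * u)
            lemma = solve-∀

  iterate-Δ-geometric : ∀ n c x s →
                        iterate (Δ 1 c) (λ t → s * x ^ t) n ≗ λ t → s * (x - c) ^ n * x ^ t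
  iterate-Δ-geometric zero    c x s t = cong (_* x ^ t) (sym (ℤ.*-identityʳ s))
  iterate-Δ-geometric (suc n) c x s t = begin
    iterate (Δ 1 c) (Δ 1 c (λ t → s * x ^ t)) n t     ≡⟨ iterate-ext (Δ-ext 1 c) n Δ-geometric t ⟩
    iterate (Δ 1 c) (λ t → s * (x - c) * x ^ t) n t   ≡⟨ iterate-Δ-geometric n c x (s * (x - c)) t ⟩
    s * (x - c) * (x - c) ^ n * x ^ t                 ≡⟨ cong (_* x ^ t) (ℤ.*-assoc s (x - c) _) ⟩
    s * (x - c) ^ suc n * x ^ t                       ∎
    where
    open ≡-Reasoning
    Δ-geometric : Δ 1 c (λ t → s * x ^ t) ≗ λ t → s * (x - c) * x ^ t
    Δ-geometric t rewrite ℕ.+-comm t 1 = lemma s x c (x ^ t)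
      where lemma : ∀ s x c e → s * (x * e) - c * (s * e) ≡ s * (x - c) * e
            lemma = solve-∀

  -- fallingΔ c k is the falling factorial (E − c)(E − c − 1) ⋯ (E − c − k + 1).
  fallingΔ : ℤ → ℕ → Op
  fallingΔ c zero    y = y
  fallingΔ c (suc k) y = fallingΔ c k (Δ 1 (c + + k) y)

  fallingΔ-ext : ∀ c k → Extensional (fallingΔ c k)
  fallingΔ-ext c zero    y≗z = y≗z
  fallingΔ-ext c (suc k) y≗z = fallingΔ-ext c k (Δ-ext 1 (c + + k) y≗z)

  fallingΔ-linear : ∀ c k (y z : Seq) s →
    fallingΔ c k (λ t → y t + s * z t) ≗ λ t → fallingΔ c k y t + s * fallingΔ c k z t
  fallingΔ-linear c zero    y z s t = refl
  fallingΔ-linear c (suc k) y z s t =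
    trans (fallingΔ-ext c k Δ-linear t) (fallingΔ-linear c k (Δ 1 (c + + k) y) (Δ 1 (c + + k) z) s t)
    where
    Δ-linear : Δ 1 (c + + k) (λ t → y t + s * z t) ≗ λ t → Δ 1 (c + + k) y t + s * Δ 1 (c + + k) z t
    Δ-linear t = lemma (y (t ℕ.+ 1)) (z (t ℕ.+ 1)) (y t) (z t) s (c + + k)
      where lemma : ∀ a b u v s w → a + s * b - w * (u + s * v) ≡ a - w * u + s * (b - w * v)
            lemma = solve-∀

  fallingΔ-+ : ∀ c k j (y : Seq) → fallingΔ c (k ℕ.+ j) y ≗ fallingΔ c k (fallingΔ (c + + k) j y)
  fallingΔ-+ c k zero    y t = cong (λ n → fallingΔ c n y t) (ℕ.+-identityʳ k)
  fallingΔ-+ c k (suc j) y t = begin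
    fallingΔ c (k ℕ.+ suc j) y t
      ≡⟨ cong (λ n → fallingΔ c n y t) (ℕ.+-suc k j) ⟩
    fallingΔ c (k ℕ.+ j) (Δ 1 (c + + (k ℕ.+ j)) y) t
      ≡⟨ fallingΔ-+ c k j _ t ⟩
    fallingΔ c k (fallingΔ (c + + k) j (Δ 1 (c + + (k ℕ.+ j)) y)) t
      ≡⟨ fallingΔ-ext c k (fallingΔ-ext (c + + k) j (λ u → cong (λ w → Δ 1 w y u) c+k+j)) t ⟩
    fallingΔ c k (fallingΔ (c + + k) j (Δ 1 (c + + k + + j) y)) t
      ∎
    where
    open ≡-Reasoning
    c+k+j : c + + (k ℕ.+ j) ≡ c + + k + + j
    c+k+j = trans (cong (λ w → c + w) (ℤ.pos-+ k j)) (sym (ℤ.+-assoc c (+ k) (+ j)))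

  iterate-Δ-stirling : ∀ c n (y : Seq) l →
    iterate (Δ 1 c) y n l ≡ sumTo n (λ k → Sℤ n k * fallingΔ c k y l)
  iterate-Δ-stirling c zero    y l = sym (ℤ.*-identityˡ (y l))
  iterate-Δ-stirling c (suc n) y l = begin
    iterate (Δ 1 c) (Δ 1 c y) n l
      ≡⟨ iterate-Δ-stirling c n (Δ 1 c y) l ⟩
    sumTo n (λ k → Sℤ n k * fallingΔ c k (Δ 1 c y) l)
      ≡⟨ sumTo-cong n (λ k _ → cong (Sℤ n k *_) (absorb k)) ⟩
    sumTo n (λ k → Sℤ n k * (+ k * fallingΔ c k y l + fallingΔ c (suc k) y l))
      ≡⟨ sumTo-stirling n (λ k → fallingΔ c k y l) ⟨
    sumTo (suc n) (λ k → Sℤ (suc n) k * fallingΔ c k y l)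
      ∎
    where
    open ≡-Reasoning
    -- E − c = (E − c − k) + k
    absorb : ∀ k → fallingΔ c k (Δ 1 c y) l ≡ + k * fallingΔ c k y l + fallingΔ c (suc k) y l
    absorb k = begin
      fallingΔ c k (Δ 1 c y) l
        ≡⟨ fallingΔ-ext c k split l ⟩
      fallingΔ c k (λ t → Δ 1 (c + + k) y t + + k * y t) l
        ≡⟨ fallingΔ-linear c k (Δ 1 (c + + k) y) y (+ k) l ⟩
      fallingΔ c (suc k) y l + + k * fallingΔ c k y l
        ≡⟨ ℤ.+-comm (fallingΔ c (suc k) y l) _ ⟩
      + k * fallingΔ c k y l + fallingΔ c (suc k) y l
        ∎
      where
      split : Δ 1 c y ≗ λ t → Δ 1 (c + + k) y t + + k * y t
      split t = lemma (y (t ℕ.+ 1)) (y t) c (+ k)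
        where lemma : ∀ a b c k → a - c * b ≡ a - (c + k) * b + k * b
              lemma = solve-∀

  -- The recurrence of T

  T-suc : ∀ a m l →
    T a m (suc l) ≡ sumTo l (λ j → Cℤ l j * ((a * Sℤ j m + Sℤ (suc j) m) * a ^ (l ℕ.∸ j)))
  T-suc a m l = begin
    T a m (suc l)
      ≡⟨ sumTo-cong (suc l) (λ j _ → ℤ.*-assoc (Cℤ (suc l) j) _ _) ⟩
    sumTo (suc l) (λ j → Cℤ (suc l) j * h j)
      ≡⟨ sumTo-pascal l h ⟩
    sumTo l (λ j → Cℤ l j * (h j + h (suc j)))
      ≡⟨ sumTo-cong l (λ j j≤l → cong (Cℤ l j *_) (term j j≤l)) ⟩
    sumTo l (λ j → Cℤ l j * ((a * Sℤ j m + Sℤ (suc j) m) * a ^ (l ℕ.∸ j)))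
      ∎
    where
    open ≡-Reasoning
    h : ℕ → ℤ
    h j = Sℤ j m * a ^ (suc l ℕ.∸ j)
    term : ∀ j → j ℕ.≤ l → h j + h (suc j) ≡ (a * Sℤ j m + Sℤ (suc j) m) * a ^ (l ℕ.∸ j)
    term j j≤l rewrite ℕ.+-∸-assoc 1 j≤l = lemma (Sℤ j m) (Sℤ (suc j) m) a (a ^ (l ℕ.∸ j))
      where lemma : ∀ s s′ a e → s * (a * e) + s′ * e ≡ (a * s + s′) * e
            lemma = solve-∀

  Δ-T-zero : ∀ a l → Δ 1 (a + 0ℤ) (T a 0) l ≡ 0ℤ
  Δ-T-zero a l = begin
    T a 0 (l ℕ.+ 1) - (a + 0ℤ) * T a 0 l
      ≡⟨ cong (λ n → T a 0 n - (a + 0ℤ) * T a 0 l) (ℕ.+-comm l 1) ⟩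
    T a 0 (suc l) - (a + 0ℤ) * T a 0 l
      ≡⟨ cong (_- (a + 0ℤ) * T a 0 l) (trans (T-suc a 0 l) (sumTo-cong l (λ j _ → term j))) ⟩
    sumTo l (λ j → a * (Cℤ l j * Sℤ j 0 * a ^ (l ℕ.∸ j))) - (a + 0ℤ) * T a 0 l
      ≡⟨ cong (_- (a + 0ℤ) * T a 0 l) (*-distribˡ-sumTo l a _) ⟨
    a * T a 0 l - (a + 0ℤ) * T a 0 l
      ≡⟨ lemma a (T a 0 l) ⟩
    0ℤ
      ∎
    where
    open ≡-Reasoning
    term : ∀ j → Cℤ l j * ((a * Sℤ j 0 + 0ℤ) * a ^ (l ℕ.∸ j))
                 ≡ a * (Cℤ l j * Sℤ j 0 * a ^ (l ℕ.∸ j))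
    term j = reassoc (Cℤ l j) a (Sℤ j 0) (a ^ (l ℕ.∸ j))
      where reassoc : ∀ c a s e → c * ((a * s + 0ℤ) * e) ≡ a * (c * s * e)
            reassoc = solve-∀
    lemma : ∀ a t → a * t - (a + 0ℤ) * t ≡ 0ℤ
    lemma = solve-∀

  Δ-T-suc : ∀ a m l → Δ 1 (a + + suc m) (T a (suc m)) l ≡ T a m l
  Δ-T-suc a m l = begin
    T a M (l ℕ.+ 1) - (a + + M) * T a M l
      ≡⟨ cong (λ n → T a M n - (a + + M) * T a M l) (ℕ.+-comm l 1) ⟩
    T a M (suc l) - (a + + M) * T a M l
      ≡⟨ cong (_- (a + + M) * T a M l) (trans (T-suc a M l) (sumTo-cong l (λ j _ → term j))) ⟩
    sumTo l (λ j → (a + + M) * t M j + t m j) - (a + + M) * T a M l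
      ≡⟨ cong (_- (a + + M) * T a M l) (sumTo-distrib-+ l _ (t m)) ⟩
    sumTo l (λ j → (a + + M) * t M j) + T a m l - (a + + M) * T a M l
      ≡⟨ cong (λ x → x + T a m l - (a + + M) * T a M l) (*-distribˡ-sumTo l (a + + M) (t M)) ⟨
    (a + + M) * T a M l + T a m l - (a + + M) * T a M l
      ≡⟨ lemma (a + + M) (T a M l) (T a m l) ⟩
    T a m l
      ∎
    where
    open ≡-Reasoning
    M = suc m
    t : ℕ → ℕ → ℤ
    t k j = Cℤ l j * Sℤ j k * a ^ (l ℕ.∸ j)
    term : ∀ j → Cℤ l j * ((a * Sℤ j M + Sℤ (suc j) M) * a ^ (l ℕ.∸ j)) ≡ (a + + M) * t M j + t m j
    term j rewrite Sℤ-suc j m = reassoc (Cℤ l j) a (Sℤ j M) (Sℤ j m) (+ M) (a ^ (l ℕ.∸ j))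
      where reassoc : ∀ c a s s′ k e →
                      c * ((a * s + (k * s + s′)) * e) ≡ (a + k) * (c * s * e) + c * s′ * e
            reassoc = solve-∀
    lemma : ∀ c x y → c * x + y - c * x ≡ y
    lemma = solve-∀

  fallingΔ-annihilates-T : ∀ a m → fallingΔ a (suc m) (T a m) ≗ λ _ → 0ℤ
  fallingΔ-annihilates-T a zero    = Δ-T-zero a
  fallingΔ-annihilates-T a (suc m) l =
    trans (fallingΔ-ext a (suc m) (Δ-T-suc a m) l) (fallingΔ-annihilates-T a m l)

  module Modular (n : ℕ) where

    infix 4 _≈_
    record _≈_ (x y : ℤ) : Set where
      constructor mk≈
      field divides-difference : + n Signed.∣ x - y
    open _≈_ public

    ≡⇒≈ : ∀ {x y} → x ≡ y → x ≈ y
    ≡⇒≈ {x} refl = mk≈ (divides 0ℤ (ℤ.+-inverseʳ x))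

    ≈-refl : ∀ {x} → x ≈ x
    ≈-refl = ≡⇒≈ refl

    ≈-sym : ∀ {x y} → x ≈ y → y ≈ x
    ≈-sym {x} {y} (mk≈ n∣x-y) = mk≈ (subst (+ n Signed.∣_) (lemma x y) (Signed.∣m⇒∣-m n∣x-y))
      where lemma : ∀ x y → - (x - y) ≡ y - x
            lemma = solve-∀

    ≈-trans : ∀ {x y z} → x ≈ y → y ≈ z → x ≈ z
    ≈-trans {x} {y} {z} (mk≈ n∣x-y) (mk≈ n∣y-z) =
      mk≈ (subst (+ n Signed.∣_) (lemma x y z) (Signed.∣m∣n⇒∣m+n n∣x-y n∣y-z))
      where lemma : ∀ x y z → (x - y) + (y - z) ≡ x - z
            lemma = solve-∀

    ≈-setoid : Setoid 0ℓ 0ℓ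
    ≈-setoid = record
      { Carrier       = ℤ
      ; _≈_           = _≈_
      ; isEquivalence = record { refl = ≈-refl ; sym = ≈-sym ; trans = ≈-trans }
      }

    module ≈-Reasoning = Relation.Binary.Reasoning.Setoid ≈-setoid

    ≈⇒∣ : ∀ {x y} → x ≈ y → + n Unsigned.∣ x - y
    ≈⇒∣ (mk≈ n∣x-y) = Signed.∣⇒∣ᵤ n∣x-y

    ∣⇒≈0 : ∀ {x} → + n Signed.∣ x → x ≈ 0ℤ
    ∣⇒≈0 {x} n∣x = mk≈ (subst (+ n Signed.∣_) (sym (ℤ.+-identityʳ x)) n∣x)

    ≈0⇒∣ : ∀ {x} → x ≈ 0ℤ → + n Signed.∣ x
    ≈0⇒∣ {x} (mk≈ n∣x-0) = subst (+ n Signed.∣_) (ℤ.+-identityʳ x) n∣x-0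

    +-cong : ∀ {x y u v} → x ≈ y → u ≈ v → x + u ≈ y + v
    +-cong {x} {y} {u} {v} (mk≈ n∣x-y) (mk≈ n∣u-v) =
      mk≈ (subst (+ n Signed.∣_) (lemma x y u v) (Signed.∣m∣n⇒∣m+n n∣x-y n∣u-v))
      where lemma : ∀ x y u v → (x - y) + (u - v) ≡ (x + u) - (y + v)
            lemma = solve-∀

    -‿cong : ∀ {x y} → x ≈ y → - x ≈ - y
    -‿cong {x} {y} (mk≈ n∣x-y) = mk≈ (subst (+ n Signed.∣_) (lemma x y) (Signed.∣m⇒∣-m n∣x-y))
      where lemma : ∀ x y → - (x - y) ≡ - x - - y
            lemma = solve-∀

    *-cong : ∀ {x y u v} → x ≈ y → u ≈ v → x * u ≈ y * v
    *-cong {x} {y} {u} {v} (mk≈ n∣x-y) (mk≈ n∣u-v) =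
      mk≈ (subst (+ n Signed.∣_) (lemma x y u v)
                 (Signed.∣m∣n⇒∣m+n (Signed.∣m⇒∣m*n u n∣x-y) (Signed.∣n⇒∣m*n y n∣u-v)))
      where lemma : ∀ x y u v → (x - y) * u + y * (u - v) ≡ x * u - y * v
            lemma = solve-∀

    ^-cong : ∀ {x y} k → x ≈ y → x ^ k ≈ y ^ k
    ^-cong zero    x≈y = ≈-refl
    ^-cong (suc k) x≈y = *-cong x≈y (^-cong k x≈y)

    *-zeroˡ-≈ : ∀ {x} y → x ≈ 0ℤ → x * y ≈ 0ℤ
    *-zeroˡ-≈ y x≈0 = ≈-trans (*-cong x≈0 ≈-refl) (≡⇒≈ (ℤ.*-zeroˡ y))

    sumTo-≈0 : ∀ N {f : ℕ → ℤ} → (∀ j → j ℕ.≤ N → f j ≈ 0ℤ) → sumTo N f ≈ 0ℤ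
    sumTo-≈0 zero    f≈0 = f≈0 0 z≤n
    sumTo-≈0 (suc N) f≈0 =
      +-cong (sumTo-≈0 N (λ j j≤N → f≈0 j (ℕ.m≤n⇒m≤1+n j≤N))) (f≈0 (suc N) ℕ.≤-refl)

    sumTo-single : ∀ N i {f : ℕ → ℤ} → i ℕ.≤ N →
                   (∀ j → j ℕ.≤ N → j ≢ i → f j ≈ 0ℤ) → sumTo N f ≈ f i
    sumTo-single zero    zero _   _   = ≈-refl
    sumTo-single (suc N) i    {f} i≤N f≈0 with i ℕ.≟ suc N
    ... | yes refl = ≈-trans
      (+-cong (sumTo-≈0 N (λ j j≤N → f≈0 j (ℕ.m≤n⇒m≤1+n j≤N) (ℕ.<⇒≢ (s≤s j≤N))))
              (≈-refl {f (suc N)}))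
      (≡⇒≈ (ℤ.+-identityˡ (f (suc N))))
    ... | no i≢1+N = ≈-trans
      (+-cong (sumTo-single N i (ℕ.≤-pred (ℕ.≤∧≢⇒< i≤N i≢1+N))
                            (λ j j≤N → f≈0 j (ℕ.m≤n⇒m≤1+n j≤N)))
              (f≈0 (suc N) ℕ.≤-refl (≢-sym i≢1+N)))
      (≡⇒≈ (ℤ.+-identityʳ (f i)))

    infix 4 _≋_
    _≋_ : Seq → Seq → Set
    y ≋ z = ∀ l → y l ≈ z l

    Congruent : Op → Set
    Congruent F = ∀ {y z} → y ≋ z → F y ≋ F z

    Δ-cong : ∀ k c → Congruent (Δ k c)
    Δ-cong k c y≋z l = +-cong (y≋z (l ℕ.+ k)) (-‿cong (*-cong (≈-refl {c}) (y≋z l)))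

    iterate-cong : ∀ {F} → Congruent F → ∀ k → Congruent (λ y → iterate F y k)
    iterate-cong F-cong zero    y≋z = y≋z
    iterate-cong F-cong (suc k) y≋z = iterate-cong F-cong k (F-cong y≋z)

    fallingΔ-cong : ∀ c k → Congruent (fallingΔ c k)
    fallingΔ-cong c zero    y≋z = y≋z
    fallingΔ-cong c (suc k) y≋z = fallingΔ-cong c k (Δ-cong 1 (c + + k) y≋z)

    iterate-≋ : ∀ {F F′} → (∀ y → F y ≋ F′ y) → Congruent F′ →
                ∀ k y → iterate F y k ≋ iterate F′ y k
    iterate-≋ F≋F′ F′-cong zero    y l = ≈-refl
    iterate-≋ {F} F≋F′ F′-cong (suc k) y l =
      ≈-trans (iterate-≋ F≋F′ F′-cong k (F y) l) (iterate-cong F′-cong k (F≋F′ y) l)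

    VanishesFrom : ℕ → Seq → Set
    VanishesFrom j y = ∀ {l} → j ℕ.≤ l → y l ≈ 0ℤ

    Δ-vanishesFrom : ∀ k c {j y} → VanishesFrom j y → VanishesFrom j (Δ k c y)
    Δ-vanishesFrom k c {y = y} y≈0 {l} j≤l = ≈-trans
      (+-cong (y≈0 (ℕ.≤-trans j≤l (ℕ.m≤m+n l k))) (-‿cong (*-cong (≈-refl {c}) (y≈0 j≤l))))
      (≡⇒≈ (lemma c))
      where lemma : ∀ c → 0ℤ - c * 0ℤ ≡ 0ℤ
            lemma = solve-∀

    iterate-Δ-vanishesFrom : ∀ k c n {j y} → VanishesFrom j y → VanishesFrom j (iterate (Δ k c) y n)
    iterate-Δ-vanishesFrom k c zero    y≈0 = y≈0
    iterate-Δ-vanishesFrom k c (suc n) y≈0 = iterate-Δ-vanishesFrom k c n (Δ-vanishesFrom k c y≈0)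

    fallingΔ-vanishesFrom : ∀ c k {j y} → VanishesFrom j y → VanishesFrom j (fallingΔ c k y)
    fallingΔ-vanishesFrom c zero    y≈0 = y≈0
    fallingΔ-vanishesFrom c (suc k) y≈0 = fallingΔ-vanishesFrom c k (Δ-vanishesFrom 1 (c + + k) y≈0)

    Δ-vanishesFrom⇒periodic : ∀ N {j} (y : Seq) → VanishesFrom j (Δ N 1ℤ y) →
                              ∀ {l} → j ℕ.≤ l → ∀ t → y (l ℕ.+ t ℕ.* N) ≈ y l
    Δ-vanishesFrom⇒periodic N y Δy≈0 {l} j≤l zero    = ≡⇒≈ (cong y (ℕ.+-identityʳ l))
    Δ-vanishesFrom⇒periodic N y Δy≈0 {l} j≤l (suc t) = begin
      y (l ℕ.+ (N ℕ.+ t ℕ.* N))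
        ≡⟨ cong y (trans (ℕ.+-comm l _) (trans (ℕ.+-assoc N (t ℕ.* N) l) (ℕ.+-comm N u))) ⟩
      y (u ℕ.+ N)
        ≡⟨ lemma (y (u ℕ.+ N)) (y u) ⟩
      (y (u ℕ.+ N) - 1ℤ * y u) + y u
        ≈⟨ +-cong (Δy≈0 (ℕ.≤-trans j≤l (ℕ.m≤n+m l (t ℕ.* N)))) (≈-refl {y u}) ⟩
      0ℤ + y u
        ≡⟨ trans (ℤ.+-identityˡ (y u)) (cong y (ℕ.+-comm (t ℕ.* N) l)) ⟩
      y (l ℕ.+ t ℕ.* N)
        ≈⟨ Δ-vanishesFrom⇒periodic N y Δy≈0 j≤l t ⟩
      y l
        ∎
      where
      open ≈-Reasoning
      u = t ℕ.* N ℕ.+ l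
      lemma : ∀ a b → a ≡ (a - 1ℤ * b) + b
      lemma = solve-∀

  module ModuloPrime {p′ : ℕ} (prime : Prime (suc p′)) where

    p : ℕ
    p = suc p′

    open Modular p public

    1<p : 1 ℕ.< p
    1<p = ℕ.nonTrivial⇒n>1 p {{prime⇒nonTrivial prime}}

    p∤k! : ∀ {k} → k ℕ.< p → ¬ p ∣ k !
    p∤k! {zero}  _   p∣1 = ℕ.<⇒≢ 1<p (sym (∣1⇒≡1 p∣1))
    p∤k! {suc k} k<p p∣k! with euclidsLemma (suc k) (k !) prime p∣k!
    ... | inj₁ p∣1+k = ℕ.<⇒≱ k<p (∣⇒≤ p∣1+k)
    ... | inj₂ p∣k!′ = p∤k! (ℕ.<-trans (ℕ.n<1+n k) k<p) p∣k!′

    p∣pCk : ∀ {k} → 0 ℕ.< k → k ℕ.< p → p ∣ p C k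
    p∣pCk {k} 0<k k<p
      with euclidsLemma (p C k) (k ! ℕ.* (p ℕ.∸ k) !) prime
             (subst (p ∣_) (sym (nCk*[k!*[n∸k]!]≡n! (ℕ.<⇒≤ k<p))) (m∣m*n (p′ !)))
    ... | inj₁ p∣pCk′ = p∣pCk′
    ... | inj₂ p∣k!*[p∸k]! with euclidsLemma (k !) ((p ℕ.∸ k) !) prime p∣k!*[p∸k]!
    ...   | inj₁ p∣k!      = ⊥-elim (p∤k! k<p p∣k!)
    ...   | inj₂ p∣[p∸k]! = ⊥-elim (p∤k! (ℕ.∸-monoʳ-< 0<k (ℕ.<⇒≤ k<p)) p∣[p∸k]!)

    ∣⇒+≈0 : ∀ {n} → p ∣ n → + n ≈ 0ℤ
    ∣⇒+≈0 p∣n = ∣⇒≈0 (Signed.∣ᵤ⇒∣ p∣n)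

    *k!≈0⇒≈0 : ∀ x {k} → k ℕ.< p → x * + (k !) ≈ 0ℤ → x ≈ 0ℤ
    *k!≈0⇒≈0 x {k} k<p x*k!≈0 with euclidsLemma ℤ.∣ x ∣ (k !) prime p∣∣x∣*k!
      where
      p∣∣x∣*k! : p ∣ ℤ.∣ x ∣ ℕ.* k !
      p∣∣x∣*k! = subst (p ∣_) (ℤ.abs-* x (+ (k !))) (Signed.∣⇒∣ᵤ (≈0⇒∣ x*k!≈0))
    ... | inj₁ p∣∣x∣ = ∣⇒≈0 (Signed.∣ᵤ⇒∣ p∣∣x∣)
    ... | inj₂ p∣k!  = ⊥-elim (p∤k! k<p p∣k!)

    iterate-Δ-binomial-p : ∀ k c (y : Seq) l →
                           iterate (Δ k c) y p l ≈ y (l ℕ.+ k ℕ.* p) + (- c) ^ p * y l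
    iterate-Δ-binomial-p k c y l = begin
      iterate (Δ k c) y p l                ≡⟨ iterate-Δ-binomial p k c y l ⟩
      sumTo p′ f + f p                     ≈⟨ +-cong (sumTo-single p′ 0 z≤n inner) ≈-refl ⟩
      f 0 + f p                            ≡⟨ ℤ.+-comm (f 0) (f p) ⟩
      f p + f 0                            ≡⟨ cong₂ _+_ last first ⟩
      y (l ℕ.+ k ℕ.* p) + (- c) ^ p * y l  ∎
      where
      open ≈-Reasoning
      f : ℕ → ℤ
      f j = Cℤ p j * ((- c) ^ (p ℕ.∸ j) * y (l ℕ.+ k ℕ.* j))
      inner : ∀ j → j ℕ.≤ p′ → j ≢ 0 → f j ≈ 0ℤ
      inner zero    _    0≢0 = ⊥-elim (0≢0 refl)
      inner (suc j) j<p′ _   = *-zeroˡ-≈ _ (∣⇒+≈0 (p∣pCk (s≤s z≤n) (s≤s j<p′)))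
      last : f p ≡ y (l ℕ.+ k ℕ.* p)
      last rewrite nCn≡1 p | ℕ.n∸n≡0 p′ = trans (ℤ.*-identityˡ _) (ℤ.*-identityˡ _)
      first : f 0 ≡ (- c) ^ p * y l
      first rewrite ℕ.*-zeroʳ k | ℕ.+-identityʳ l = ℤ.*-identityˡ _

    -- (n + 1)^p ≡ n^p + 1 is the binomial congruence applied to the geometric sequence (n^t).
    fermat-ℕ : ∀ n → (+ n) ^ p ≈ + n
    fermat-ℕ zero    = ≡⇒≈ (ℤ.*-zeroˡ (0ℤ ^ p′))
    fermat-ℕ (suc n) = begin
      (+ suc n) ^ p
        ≡⟨ cong (_^ p) (ℤ.+-comm (+ n) 1ℤ) ⟨
      (+ n - -1ℤ) ^ p
        ≡⟨ trans (ℤ.*-identityʳ _) (ℤ.*-identityˡ _) ⟨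
      1ℤ * (+ n - -1ℤ) ^ p * (+ n) ^ 0
        ≡⟨ iterate-Δ-geometric p -1ℤ (+ n) 1ℤ 0 ⟨
      iterate (Δ 1 -1ℤ) (λ t → 1ℤ * (+ n) ^ t) p 0
        ≈⟨ iterate-Δ-binomial-p 1 -1ℤ (λ t → 1ℤ * (+ n) ^ t) 0 ⟩
      1ℤ * (+ n) ^ (1 ℕ.* p) + 1ℤ ^ p * (1ℤ * 1ℤ)
        ≡⟨ cong₂ _+_ (trans (ℤ.*-identityˡ _) (cong ((+ n) ^_) (ℕ.*-identityˡ p)))
                     (trans (ℤ.*-identityʳ (1ℤ ^ p)) (ℤ.^-zeroˡ p)) ⟩
      (+ n) ^ p + 1ℤ
        ≈⟨ +-cong (fermat-ℕ n) ≈-refl ⟩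
      + n + 1ℤ
        ≡⟨ ℤ.+-comm (+ n) 1ℤ ⟩
      + suc n
        ∎
      where open ≈-Reasoning

    fermat : ∀ x → x ^ p ≈ x
    fermat x = ≈-trans (^-cong p x≈r) (≈-trans (fermat-ℕ (x %ℕ p)) (≈-sym x≈r))
      where
      x≈r : x ≈ + (x %ℕ p)
      x≈r = mk≈ (divides (x /ℕ p) (begin
        x - + (x %ℕ p)                            ≡⟨ cong (_- + (x %ℕ p)) (a≡a%ℕn+[a/ℕn]*n x p) ⟩
        + (x %ℕ p) + (x /ℕ p) * + p - + (x %ℕ p)  ≡⟨ lemma (+ (x %ℕ p)) ((x /ℕ p) * + p) ⟩
        (x /ℕ p) * + p                            ∎))
        where
        open ≡-Reasoning
        lemma : ∀ r s → r + s - r ≡ s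
        lemma = solve-∀

    iterate-Δ-frobenius : ∀ k c y → iterate (Δ k c) y p ≋ Δ (k ℕ.* p) c y
    iterate-Δ-frobenius k c y l = begin
      iterate (Δ k c) y p l
        ≈⟨ iterate-Δ-binomial-p k c y l ⟩
      y (l ℕ.+ k ℕ.* p) + (- c) ^ p * y l
        ≈⟨ +-cong (≈-refl {y (l ℕ.+ k ℕ.* p)}) (*-cong (fermat (- c)) (≈-refl {y l})) ⟩
      y (l ℕ.+ k ℕ.* p) + (- c) * y l
        ≡⟨ cong (λ w → y (l ℕ.+ k ℕ.* p) + w) (ℤ.neg-distribˡ-* c (y l)) ⟨
      Δ (k ℕ.* p) c y l
        ∎
      where open ≈-Reasoning

    S[p,k]≈0 : ∀ k → 2 ℕ.≤ k → k ℕ.< p → Sℤ p k ≈ 0ℤ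
    S[p,k]≈0 = <-rec (λ k → 2 ℕ.≤ k → k ℕ.< p → Sℤ p k ≈ 0ℤ) step
      where
      step : ∀ k → (∀ {i} → i ℕ.< k → 2 ℕ.≤ i → i ℕ.< p → Sℤ p i ≈ 0ℤ) →
             2 ℕ.≤ k → k ℕ.< p → Sℤ p k ≈ 0ℤ
      step 1               _  (s≤s ()) _
      step k@(suc (suc j)) IH _        k<p =
        *k!≈0⇒≈0 (Sℤ p k) k<p (≈-trans (≡⇒≈ (cong (Sℤ p k *_) (sym (falling[k,k]≡k! k)))) fk≈0)
        where
        f : ℕ → ℤ
        f i = Sℤ p i * falling (+ k) i
        inner : ∀ i → i ℕ.≤ suc j → i ≢ 1 → f i ≈ 0ℤ
        inner zero          _       _   = ≈-refl
        inner (suc zero)    _       1≢1 = ⊥-elim (1≢1 refl)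
        inner (suc (suc i)) 2+i≤1+j _   =
          *-zeroˡ-≈ _ (IH (s≤s 2+i≤1+j) (s≤s (s≤s z≤n)) (ℕ.<-trans (s≤s 2+i≤1+j) k<p))
        f1≡k : f 1 ≡ + k
        f1≡k rewrite S[1+n,1]≡1 p′ = lemma (+ k)
          where lemma : ∀ x → 1ℤ * (1ℤ * (x - 0ℤ)) ≡ x
                lemma = solve-∀
        -- Stirling's expansion of k ^ p stops at the k-th term, and all but two terms vanish mod p.
        fk≈0 : f k ≈ 0ℤ
        fk≈0 = begin
          f k
            ≡⟨ lemma (+ k) (f k) ⟩
          (+ k + f k) - + k
            ≡⟨ cong (λ x → (x + f k) - + k) f1≡k ⟨
          (f 1 + f k) - + k
            ≈⟨ +-cong (+-cong (≈-sym (sumTo-single (suc j) 1 (s≤s z≤n) inner)) (≈-refl {f k}))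
                      (≈-refl {x = - + k}) ⟩
          (sumTo (suc j) f + f k) - + k
            ≡⟨ cong (_- + k) (trans (sym (sumTo-truncate f (ℕ.<⇒≤ k<p) vanish))
                                    (sym (^≡sumTo-S*falling (+ k) p))) ⟩
          (+ k) ^ p - + k
            ≈⟨ +-cong (fermat (+ k)) (≈-refl {x = - + k}) ⟩
          + k - + k
            ≡⟨ ℤ.+-inverseʳ (+ k) ⟩
          0ℤ
            ∎
          where
          open ≈-Reasoning
          lemma : ∀ a b → b ≡ (a + b) - a
          lemma = solve-∀
          vanish : ∀ i → k ℕ.< i → f i ≡ 0ℤ
          vanish i k<i = trans (cong (Sℤ p i *_) (k<j⇒falling[k,j]≡0 k<i)) (ℤ.*-zeroʳ (Sℤ p i))

    -- E^p − E = E (E^(p−1) − 1)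
    E^p-E : Op
    E^p-E y l = Δ p′ 1ℤ y (suc l)

    E^p-E-cong : Congruent E^p-E
    E^p-E-cong y≋z l = Δ-cong p′ 1ℤ y≋z (suc l)

    fallingΔ-p≈E^p-E : ∀ c y → fallingΔ c p y ≋ E^p-E y
    fallingΔ-p≈E^p-E c y l = begin
      F
        ≡⟨ lemma (sumTo p′ g) F ⟩
      (sumTo p′ g + 1ℤ * F) - sumTo p′ g
        ≡⟨ cong (λ s → (sumTo p′ g + + s * F) - sumTo p′ g) (S[n,n]≡1 p) ⟨
      (sumTo p′ g + g p) - sumTo p′ g
        ≡⟨ cong (_- sumTo p′ g) (iterate-Δ-stirling c p y l) ⟨
      iterate (Δ 1 c) y p l - sumTo p′ g
        ≈⟨ +-cong (iterate-Δ-frobenius 1 c y l) (-‿cong (sumTo-single p′ 1 (ℕ.≤-pred 1<p) inner)) ⟩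
      Δ (1 ℕ.* p) c y l - g 1
        ≡⟨ cong₂ (λ u v → u - c * y l - v * Δ 1 (c + 0ℤ) y l)
                 (cong y l+1*p≡1+l+p′) (cong +_ (S[1+n,1]≡1 p′)) ⟩
      y (suc l ℕ.+ p′) - c * y l - 1ℤ * Δ 1 (c + 0ℤ) y l
        ≡⟨ cong (λ u → y (suc l ℕ.+ p′) - c * y l - 1ℤ * (y u - (c + 0ℤ) * y l)) (ℕ.+-comm l 1) ⟩
      y (suc l ℕ.+ p′) - c * y l - 1ℤ * (y (suc l) - (c + 0ℤ) * y l)
        ≡⟨ lemma′ (y (suc l ℕ.+ p′)) (y (suc l)) c (y l) ⟩
      E^p-E y l
        ∎
      where
      open ≈-Reasoning
      F = fallingΔ c p y l
      g : ℕ → ℤ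
      g k = Sℤ p k * fallingΔ c k y l
      inner : ∀ k → k ℕ.≤ p′ → k ≢ 1 → g k ≈ 0ℤ
      inner zero          _      _   = ≈-refl
      inner (suc zero)    _      1≢1 = ⊥-elim (1≢1 refl)
      inner (suc (suc k)) 2+k≤p′ _   =
        *-zeroˡ-≈ _ (S[p,k]≈0 (suc (suc k)) (s≤s (s≤s z≤n)) (s≤s 2+k≤p′))
      l+1*p≡1+l+p′ : l ℕ.+ 1 ℕ.* p ≡ suc l ℕ.+ p′
      l+1*p≡1+l+p′ = trans (cong (l ℕ.+_) (ℕ.*-identityˡ p)) (ℕ.+-suc l p′)
      lemma : ∀ s f → f ≡ (s + 1ℤ * f) - s
      lemma = solve-∀
      lemma′ : ∀ a b c u → a - c * u - 1ℤ * (b - (c + 0ℤ) * u) ≡ a - 1ℤ * b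
      lemma′ = solve-∀

    fallingΔ-*p≈iterate-E^p-E : ∀ c q y → fallingΔ c (q ℕ.* p) y ≋ iterate E^p-E y q
    fallingΔ-*p≈iterate-E^p-E c zero    y l = ≈-refl
    fallingΔ-*p≈iterate-E^p-E c (suc q) y l = begin
      fallingΔ c (p ℕ.+ q ℕ.* p) y l
        ≡⟨ fallingΔ-+ c p (q ℕ.* p) y l ⟩
      fallingΔ c p (fallingΔ (c + + p) (q ℕ.* p) y) l
        ≈⟨ fallingΔ-p≈E^p-E c (fallingΔ (c + + p) (q ℕ.* p) y) l ⟩
      E^p-E (fallingΔ (c + + p) (q ℕ.* p) y) l
        ≈⟨ E^p-E-cong (fallingΔ-*p≈iterate-E^p-E (c + + p) q y) l ⟩
      E^p-E (iterate E^p-E y q) l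
        ≡⟨ cong (λ z → z l) (iterate-suc E^p-E y q) ⟨
      iterate E^p-E y (suc q) l
        ∎
      where open ≈-Reasoning

    -- Completing (E − c)_r to p consecutive factors: (E − c + p − r)_p = (E − c + p − r)_(p−r) (E − c)_r.
    fallingΔ≈0⇒E^p-E≈0 : ∀ c r z → r ℕ.≤ p →
                         VanishesFrom 0 (fallingΔ c r z) → VanishesFrom 0 (E^p-E z)
    fallingΔ≈0⇒E^p-E≈0 c r z r≤p Fz≈0 {l} _ = begin
      E^p-E z l
        ≈⟨ fallingΔ-p≈E^p-E c′ z l ⟨
      fallingΔ c′ p z l
        ≡⟨ cong (λ n → fallingΔ c′ n z l) (ℕ.m∸n+n≡m r≤p) ⟨
      fallingΔ c′ (d ℕ.+ r) z l
        ≡⟨ fallingΔ-+ c′ d r z l ⟩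
      fallingΔ c′ d (fallingΔ (c′ + + d) r z) l
        ≡⟨ cong (λ c → fallingΔ c′ d (fallingΔ c r z) l) (lemma c (+ d)) ⟩
      fallingΔ c′ d (fallingΔ c r z) l
        ≈⟨ fallingΔ-vanishesFrom c′ d Fz≈0 z≤n ⟩
      0ℤ
        ∎
      where
      open ≈-Reasoning
      d = p ℕ.∸ r
      c′ = c - + d
      lemma : ∀ c d → c - d + d ≡ c
      lemma = solve-∀

    E^p-E-annihilates-T : ∀ a m → VanishesFrom 0 (iterate E^p-E (T a m) (suc (m / p)))
    E^p-E-annihilates-T a m {l} _ = begin
      iterate E^p-E (T a m) (suc q) l
        ≡⟨ cong (λ z → z l) (iterate-suc E^p-E (T a m) q) ⟩
      E^p-E (iterate E^p-E (T a m) q) l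
        ≈⟨ fallingΔ≈0⇒E^p-E≈0 a r (iterate E^p-E (T a m) q) (m%n<n m p) V≈0 z≤n ⟩
      0ℤ
        ∎
      where
      open ≈-Reasoning
      q = m / p
      r = suc (m % p)
      V≈0 : VanishesFrom 0 (fallingΔ a r (iterate E^p-E (T a m) q))
      V≈0 {t} _ = begin
        fallingΔ a r (iterate E^p-E (T a m) q) t
          ≈⟨ fallingΔ-cong a r (fallingΔ-*p≈iterate-E^p-E (a + + r) q (T a m)) t ⟨
        fallingΔ a r (fallingΔ (a + + r) (q ℕ.* p) (T a m)) t
          ≡⟨ fallingΔ-+ a r (q ℕ.* p) (T a m) t ⟨
        fallingΔ a (r ℕ.+ q ℕ.* p) (T a m) t
          ≡⟨ cong (λ n → fallingΔ a (suc n) (T a m) t) (m≡m%n+[m/n]*n m p) ⟨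
        fallingΔ a (suc m) (T a m) t
          ≡⟨ fallingΔ-annihilates-T a m t ⟩
        0ℤ
          ∎

    E^p-E-annihilates-T-δ : ∀ a m q → a ≈ 0ℤ → m ≡ q ℕ.* p → VanishesFrom 1 (iterate E^p-E (T a m) q)
    E^p-E-annihilates-T-δ a m q a≈0 m≡q*p {suc t} _ = begin
      iterate E^p-E (T a m) q (suc t)
        ≡⟨ cong (iterate E^p-E (T a m) q) (ℕ.+-comm 1 t) ⟩
      iterate E^p-E (T a m) q (t ℕ.+ 1)
        ≈⟨ fallingΔ-*p≈iterate-E^p-E (a + 1ℤ) q (T a m) (t ℕ.+ 1) ⟨
      U (t ℕ.+ 1)
        ≡⟨ lemma (U (t ℕ.+ 1)) (a + 0ℤ) (U t) ⟩
      Δ 1 (a + 0ℤ) U t + (a + 0ℤ) * U t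
        ≈⟨ +-cong (≡⇒≈ ΔU≡0) (*-zeroˡ-≈ (U t) (≈-trans (≡⇒≈ (ℤ.+-identityʳ a)) a≈0)) ⟩
      0ℤ + 0ℤ
        ∎
      where
      open ≈-Reasoning
      U = fallingΔ (a + 1ℤ) (q ℕ.* p) (T a m)
      lemma : ∀ x c y → x ≡ x - c * y + c * y
      lemma = solve-∀
      ΔU≡0 : Δ 1 (a + 0ℤ) U t ≡ 0ℤ
      ΔU≡0 = trans (sym (fallingΔ-+ a 1 (q ℕ.* p) (T a m) t))
                   (trans (cong (λ n → fallingΔ a (suc n) (T a m) t) (sym m≡q*p))
                          (fallingΔ-annihilates-T a m t))

    iterate-E^p-E-shift : ∀ q y l → iterate E^p-E y q l ≡ iterate (Δ p′ 1ℤ) y q (q ℕ.+ l)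
    iterate-E^p-E-shift zero    y l = refl
    iterate-E^p-E-shift (suc q) y l =
      trans (iterate-E^p-E-shift q (E^p-E y) l) (iterate-Δ-suc p′ 1ℤ q (Δ p′ 1ℤ y) (q ℕ.+ l))

    iterate-E^p-E-vanishesFrom : ∀ {i k} y → VanishesFrom i (iterate E^p-E y k) →
                                 VanishesFrom (i ℕ.+ k) (iterate (Δ p′ 1ℤ) y k)
    iterate-E^p-E-vanishesFrom {i} {k} y V≈0 {l} i+k≤l =
      subst (λ n → iterate (Δ p′ 1ℤ) y k n ≈ 0ℤ) (ℕ.m+[n∸m]≡n (ℕ.m+n≤o⇒n≤o i i+k≤l))
        (subst (_≈ 0ℤ) (iterate-E^p-E-shift k y (l ℕ.∸ k)) (V≈0 (ℕ.m+n≤o⇒m≤o∸n i i+k≤l)))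

    iterate-Δ-frobenius-p^s : ∀ s y → iterate (Δ p′ 1ℤ) y (p ℕ.^ s) ≋ Δ (p′ ℕ.* p ℕ.^ s) 1ℤ y
    iterate-Δ-frobenius-p^s zero    y l =
      ≡⇒≈ (cong (λ n → y (l ℕ.+ n) - 1ℤ * y l) (sym (ℕ.*-identityʳ p′)))
    iterate-Δ-frobenius-p^s (suc s) y l = begin
      iterate (Δ p′ 1ℤ) y (p ℕ.* p ℕ.^ s) l
        ≡⟨ cong (λ z → z l) (iterate-* (Δ p′ 1ℤ) y p (p ℕ.^ s)) ⟩
      iterate (λ z → iterate (Δ p′ 1ℤ) z (p ℕ.^ s)) y p l
        ≈⟨ iterate-≋ (iterate-Δ-frobenius-p^s s) (Δ-cong N 1ℤ) p y l ⟩
      iterate (Δ N 1ℤ) y p l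
        ≈⟨ iterate-Δ-frobenius N 1ℤ y l ⟩
      Δ (N ℕ.* p) 1ℤ y l
        ≡⟨ cong (λ n → y (l ℕ.+ n) - 1ℤ * y l) N*p≡p′*p^[1+s] ⟩
      Δ (p′ ℕ.* p ℕ.^ suc s) 1ℤ y l
        ∎
      where
      open ≈-Reasoning
      N = p′ ℕ.* p ℕ.^ s
      N*p≡p′*p^[1+s] : N ℕ.* p ≡ p′ ℕ.* (p ℕ.* p ℕ.^ s)
      N*p≡p′*p^[1+s] = trans (ℕ.*-assoc p′ (p ℕ.^ s) p) (cong (p′ ℕ.*_) (ℕ.*-comm (p ℕ.^ s) p))

    eventually-periodic : ∀ {k s j} y → k ℕ.≤ p ℕ.^ s → VanishesFrom j (iterate (Δ p′ 1ℤ) y k) →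
                          ∀ {l l′} → j ℕ.≤ l → l ℕ.≤ l′ → (p′ ℕ.* p ℕ.^ s) ∣ (l′ ℕ.∸ l) →
                          y l′ ≈ y l
    eventually-periodic {k} {s} {j} y k≤p^s Gᵏy≈0 {l} {l′} j≤l l≤l′ (divides t l′∸l≡t*N) =
      subst (λ n → y n ≈ y l) (trans (cong (l ℕ.+_) (sym l′∸l≡t*N)) (ℕ.m+[n∸m]≡n l≤l′))
        (Δ-vanishesFrom⇒periodic (p′ ℕ.* p ℕ.^ s) y Δy≈0 j≤l t)
      where
      G = Δ p′ 1ℤ
      Δy≈0 : VanishesFrom j (Δ (p′ ℕ.* p ℕ.^ s) 1ℤ y)
      Δy≈0 {l} j≤l = begin
        Δ (p′ ℕ.* p ℕ.^ s) 1ℤ y l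
          ≈⟨ iterate-Δ-frobenius-p^s s y l ⟨
        iterate G y (p ℕ.^ s) l
          ≡⟨ cong (λ n → iterate G y n l) (ℕ.m+[n∸m]≡n k≤p^s) ⟨
        iterate G y (k ℕ.+ (p ℕ.^ s ℕ.∸ k)) l
          ≡⟨ cong (λ z → z l) (iterate-+ G y k (p ℕ.^ s ℕ.∸ k)) ⟩
        iterate G (iterate G y k) (p ℕ.^ s ℕ.∸ k) l
          ≈⟨ iterate-Δ-vanishesFrom p′ 1ℤ (p ℕ.^ s ℕ.∸ k) Gᵏy≈0 j≤l ⟩
        0ℤ
          ∎
        where open ≈-Reasoning

    m<p*n⇒m/p<n : ∀ {m n} → m ℕ.< p ℕ.* n → m / p ℕ.< n
    m<p*n⇒m/p<n {m} {n} m<pn =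
      ℕ.*-cancelʳ-< p (m / p) n (ℕ.≤-<-trans (m/n*n≤m m p) (subst (m ℕ.<_) (ℕ.*-comm p n) m<pn))

    T-periodic : ∀ a m e {l l′} → m ℕ.< p ℕ.* l → m ℕ.< p ℕ.^ suc e → l ℕ.≤ l′ →
                 (p′ ℕ.* p ℕ.^ e) ∣ (l′ ℕ.∸ l) → T a m l′ ≈ T a m l
    T-periodic a m e m<pl m<pᵉ⁺¹ = eventually-periodic {s = e} (T a m) (m<p*n⇒m/p<n m<pᵉ⁺¹)
      (iterate-E^p-E-vanishesFrom (T a m) (E^p-E-annihilates-T a m)) (m<p*n⇒m/p<n m<pl)

    T-periodic-δ : ∀ a m e {l l′} → p ∣ ℤ.∣ a ∣ → p ℕ.^ suc e ≡ m → m ℕ.< p ℕ.* l → l ℕ.≤ l′ →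
                   (p′ ℕ.* p ℕ.^ e) ∣ (l′ ℕ.∸ l) → T a m l′ ≈ T a m l
    T-periodic-δ a m e {l} p∣a pᵉ⁺¹≡m m<pl = eventually-periodic {s = e} (T a m) ℕ.≤-refl
      (iterate-E^p-E-vanishesFrom (T a m) (E^p-E-annihilates-T-δ a m (p ℕ.^ e) a≈0 m≡pᵉ*p))
      (ℕ.*-cancelˡ-< p (p ℕ.^ e) l (subst (ℕ._< p ℕ.* l) (sym pᵉ⁺¹≡m) m<pl))
      where
      a≈0 : a ≈ 0ℤ
      a≈0 = ∣⇒≈0 (Signed.∣ᵤ⇒∣ p∣a)
      m≡pᵉ*p : m ≡ p ℕ.^ e ℕ.* p
      m≡pᵉ*p = trans (sym pᵉ⁺¹≡m) (ℕ.*-comm p (p ℕ.^ e))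

  δ-cases : ∀ p a m e → δ p a m e ≡ 0 ⊎ (δ p a m e ≡ 1 × p ∣ ℤ.∣ a ∣ × 1 ℕ.≤ e × p ℕ.^ e ≡ m)
  δ-cases p a m e with p ∣? ℤ.∣ a ∣ | 1 ℕ.≤? e | p ℕ.^ e ℕ.≟ m
  ... | yes p∣a | yes 1≤e | yes pᵉ≡m = inj₂ (refl , p∣a , 1≤e , pᵉ≡m)
  ... | yes _   | yes _   | no _     = inj₁ refl
  ... | yes _   | no _    | _        = inj₁ refl
  ... | no _    | _       | _        = inj₁ refl

open import Data.Nat using (ℕ; suc; _≤_; _<_; _*_; _∸_; _^_)
open import Data.Nat.Primality using (Prime)
open import Data.Integer using (ℤ; +_; _-_)
open import Data.Integer.Divisibility using (_∣_)
open import Data.Nat.Divisibility renaming (_∣_ to _∣ℕ_)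
open import Data.Empty using (⊥-elim)
open import Data.Nat using (zero; z≤n; s≤s)
open import Data.Nat.Primality using (¬prime[0])
open import Data.Product using (_,_)
open import Data.Sum using (inj₁; inj₂)
open import Relation.Binary.PropositionalEquality using (subst)

theorem1p1 : (p : ℕ) → Prime p → (a : ℤ) → (l l′ m : ℕ) →
    1 ≤ l → 1 ≤ m → l ≤ l′ → m < p * l →
    (e : ℕ) → p ^ e ≤ m → m < p ^ suc e →
    ((p ∸ 1) * p ^ (e ∸ δ p a m e)) ∣ℕ (l′ ∸ l) →
    (+ p) ∣ (T a m l′ - T a m l)
theorem1p1 zero     p-prime = ⊥-elim (¬prime[0] p-prime)
theorem1p1 (suc p′) p-prime a l l′ m _ _ l≤l′ m<pl e _ m<pᵉ⁺¹ N∣l′∸l with δ-cases (suc p′) a m e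
... | inj₁ δ≡0 =
  ≈⇒∣ (T-periodic a m e m<pl m<pᵉ⁺¹ l≤l′
                  (subst (λ d → p′ * suc p′ ^ (e ∸ d) ∣ℕ l′ ∸ l) δ≡0 N∣l′∸l))
  where open ModuloPrime p-prime
... | inj₂ (δ≡1 , p∣a , s≤s {n = e′} z≤n , pᵉ≡m) =
  ≈⇒∣ (T-periodic-δ a m e′ p∣a pᵉ≡m m<pl l≤l′
                    (subst (λ d → p′ * suc p′ ^ (suc e′ ∸ d) ∣ℕ l′ ∸ l) δ≡1 N∣l′∸l))
  where open ModuloPrime p-prime
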